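{- Let $t \ge 2$ and $n \ge 3$ be integers. Then for every integer $\ell$ with $2 \le \ell \le n$, the graph $P_{\ell t}\Diamond_{\ell} C_n$ is isomorphic to the graph $P_{(n-\ell+2)t}\Diamond_{n-\ell+2} C_n$.
   Context: $P_m$ denotes the path $v_1v_2\cdots v_m$ on $m$ vertices and $C_n$ the cycle on $n$ vertices. Path-aligned product: let $\ell, m$ be positive integers with $\ell$ dividing $m$, and let $G$ be a connected vertex-transitive graph containing the path $P_\ell$ as a subgraph. The graph $P_m \Diamond_\ell G$ is formed from the path $P_m=v_1\cdots v_m$ and $m/\ell$ pairwise disjoint copies of $G$ as follows: for each $1\le i\le m/\ell$, the $i$-th block of the path, namely the consecutive vertices $v_j, v_{j+1},\ldots,v_{j+\ell-1}$ with $j=(i-1)\ell+1$, is identified (in order) with the vertices of a path $P_\ell$ in the $i$-th copy of $G$. Thus consecutive copies of $G$ are joined only by the path edge $v_{i\ell}v_{i\ell+1}$. For $G=C_n$, a subgraph $P_\ell$ consists of $\ell$ consecutive vertices of the cycle. -}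

module Defs where

open import Data.Nat using (ℕ; zero; suc; _∸_)
open import Data.Fin using (Fin; toℕ)
open import Data.Product using (_×_; _,_; Σ)
open import Function.Bundles using (_↔_; _⇔_; Inverse)
open import Relation.Binary.PropositionalEquality using (_≡_)

record Graph : Set₁ where
  field
    V   : Set
    Adj : V → V → Set

open Graph public

_≅_ : Graph → Graph → Set
G ≅ H = Σ (V G ↔ V H) λ f →
  ∀ u v → Adj G u v ⇔ Adj H (Inverse.to f u) (Inverse.to f v)

data CycAdj (n : ℕ) : Fin n → Fin n → Set where
  fwd  : ∀ {j j'} → suc (toℕ j) ≡ toℕ j' → CycAdj n j j'
  bwd  : ∀ {j j'} → suc (toℕ j') ≡ toℕ j → CycAdj n j j'
  wrap₁ : ∀ {j j'} → suc (toℕ j) ≡ n → toℕ j' ≡ 0 → CycAdj n j j'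
  wrap₂ : ∀ {j j'} → suc (toℕ j') ≡ n → toℕ j ≡ 0 → CycAdj n j j'

-- Vertex (i , j) = vertex j of the i-th copy of C_n (i < t, j < n).
-- The i-th block v_{iℓ+1} … v_{iℓ+ℓ} of the path P_{ℓt} is identified, in order,
-- with the consecutive cycle vertices 0,1,…,ℓ-1 of copy i; so the path edges inside
-- a block are cycle edges, and the only extra edges are the path edges
-- v_{(i+1)ℓ} v_{(i+1)ℓ+1}, i.e. (i , ℓ-1) ~ (i+1 , 0).
data PCAdj (ℓ t n : ℕ) : (Fin t × Fin n) → (Fin t × Fin n) → Set where
  cycle : ∀ {i j j'} → CycAdj n j j' → PCAdj ℓ t n (i , j) (i , j')
  link₁ : ∀ {i i' j j'} → suc (toℕ i) ≡ toℕ i' → toℕ j ≡ ℓ ∸ 1 → toℕ j' ≡ 0 →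
          PCAdj ℓ t n (i , j) (i' , j')
  link₂ : ∀ {i i' j j'} → suc (toℕ i') ≡ toℕ i → toℕ j' ≡ ℓ ∸ 1 → toℕ j ≡ 0 →
          PCAdj ℓ t n (i , j) (i' , j')

PathCycle : (ℓ t n : ℕ) → Graph
PathCycle ℓ t n = record { V = Fin t × Fin n ; Adj = PCAdj ℓ t n }

{-# OPTIONS --safe #-}
-- Reflect every copy of C_n by j ↦ −j (mod n). This is an automorphism of C_n that
-- fixes vertex 0, where each copy is entered from the previous one, and sends
-- vertex ℓ − 1, where the next copy is left, to n − ℓ + 1 = (n − ℓ + 2) − 1.
-- Applied copywise, it carries P_{ℓt} ◇_ℓ C_n onto P_{(n−ℓ+2)t} ◇_{n−ℓ+2} C_n.
module Submission where

open import Defs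
open import Data.Nat using (ℕ; suc; s≤s; _≤_; _+_; _∸_)
open import Data.Nat.Properties
  using (+-comm; +-assoc; +-∸-assoc; ∸-+-assoc; m+n∸m≡n; m+n∸n≡m; m+[n∸m]≡n; m≤n+m; suc-injective)
open import Data.Fin using (Fin; zero; suc; toℕ; opposite)
open import Data.Fin.Properties using (opposite-prop; opposite-involutive; toℕ<n; toℕ≤n)
open import Data.Product using (_,_; map₂)
open import Function.Bundles using (mk↔ₛ′; mk⇔)
open import Relation.Binary.PropositionalEquality
  using (_≡_; refl; trans; cong; subst₂; module ≡-Reasoning)

CycAdj-sym : ∀ {n j j'} → CycAdj n j j' → CycAdj n j' j
CycAdj-sym (fwd p)     = bwd p
CycAdj-sym (bwd p)     = fwd p
CycAdj-sym (wrap₁ p q) = wrap₂ p q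
CycAdj-sym (wrap₂ p q) = wrap₁ p q

module _ {t n : ℕ} (σ : Fin n → Fin n)
         (σ-CycAdj : ∀ {j j'} → CycAdj n j j' → CycAdj n (σ j) (σ j'))
         (σ-zero : ∀ {j} → toℕ j ≡ 0 → toℕ (σ j) ≡ 0) where

  map₂-PCAdj : ∀ {ℓ ℓ' u v} → (∀ {j} → toℕ j ≡ ℓ ∸ 1 → toℕ (σ j) ≡ ℓ' ∸ 1) →
               PCAdj ℓ t n u v → PCAdj ℓ' t n (map₂ σ u) (map₂ σ v)
  map₂-PCAdj _     (cycle c)     = cycle (σ-CycAdj c)
  map₂-PCAdj σ-end (link₁ p q r) = link₁ p (σ-end q) (σ-zero r)
  map₂-PCAdj σ-end (link₂ p q r) = link₂ p (σ-end q) (σ-zero r)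

  involution⇒PathCycle-≅ : ∀ {ℓ ℓ'} → (∀ j → σ (σ j) ≡ j) →
    (∀ {j} → toℕ j ≡ ℓ ∸ 1 → toℕ (σ j) ≡ ℓ' ∸ 1) →
    (∀ {j} → toℕ j ≡ ℓ' ∸ 1 → toℕ (σ j) ≡ ℓ ∸ 1) →
    PathCycle ℓ t n ≅ PathCycle ℓ' t n
  involution⇒PathCycle-≅ {ℓ} σ-involutive σ-end σ-end⁻ =
    mk↔ₛ′ (map₂ σ) (map₂ σ) map₂-σ-involutive map₂-σ-involutive ,
    λ u v → mk⇔ (map₂-PCAdj σ-end)
      (λ adj → subst₂ (PCAdj ℓ t n) (map₂-σ-involutive u) (map₂-σ-involutive v)
                 (map₂-PCAdj σ-end⁻ adj))
    where
    map₂-σ-involutive : ∀ u → map₂ σ (map₂ σ u) ≡ u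
    map₂-σ-involutive (i , j) = cong (i ,_) (σ-involutive j)

reflect : ∀ {n} → Fin n → Fin n
reflect zero    = zero
reflect (suc k) = suc (opposite k)

reflect-involutive : ∀ {n} (j : Fin n) → reflect (reflect j) ≡ j
reflect-involutive zero    = refl
reflect-involutive (suc k) = cong suc (opposite-involutive k)

toℕ-reflect-zero : ∀ {n} {j : Fin n} → toℕ j ≡ 0 → toℕ (reflect j) ≡ 0
toℕ-reflect-zero {j = zero} _ = refl

toℕ-reflect-suc : ∀ {m} (k : Fin m) → toℕ (reflect (suc k)) ≡ suc m ∸ toℕ (suc k)
toℕ-reflect-suc {m} k = begin
  suc (toℕ (opposite k))    ≡⟨ cong suc (opposite-prop k) ⟩
  suc (m ∸ suc (toℕ k))     ≡⟨ +-∸-assoc 1 (toℕ<n k) ⟨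
  m ∸ toℕ k                 ∎
  where open ≡-Reasoning

reflect-successor : ∀ {n} (j j' : Fin n) → suc (toℕ j) ≡ toℕ j' → CycAdj n (reflect j) (reflect j')
reflect-successor zero (suc zero)     _ = wrap₂ (cong suc (toℕ-reflect-suc zero)) refl
reflect-successor zero (suc (suc _)) ()
reflect-successor {n} (suc k) (suc k') p = bwd (begin
  suc (toℕ (reflect (suc k')))  ≡⟨ cong suc (toℕ-reflect-suc k') ⟩
  suc (n ∸ toℕ (suc k'))        ≡⟨ +-∸-assoc 1 (toℕ≤n (suc k')) ⟨
  suc n ∸ toℕ (suc k')          ≡⟨ cong (suc n ∸_) p ⟨
  n ∸ toℕ (suc k)               ≡⟨ toℕ-reflect-suc k ⟨
  toℕ (reflect (suc k))         ∎)
  where open ≡-Reasoning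

reflect-wrap : ∀ {n} (j j' : Fin n) → suc (toℕ j) ≡ n → toℕ j' ≡ 0 → CycAdj n (reflect j) (reflect j')
reflect-wrap zero    zero p _ = wrap₁ p refl
reflect-wrap {n} (suc k) zero p _ = bwd (begin
  1                              ≡⟨ m+n∸n≡m 1 (toℕ (suc k)) ⟨
  suc (toℕ (suc k)) ∸ toℕ (suc k) ≡⟨ cong (_∸ toℕ (suc k)) p ⟩
  n ∸ toℕ (suc k)                ≡⟨ toℕ-reflect-suc k ⟨
  toℕ (reflect (suc k))          ∎)
  where open ≡-Reasoning

reflect-CycAdj : ∀ {n j j'} → CycAdj n j j' → CycAdj n (reflect j) (reflect j')
reflect-CycAdj {j = j} {j'} (fwd p)     = reflect-successor j j' p
reflect-CycAdj {j = j} {j'} (bwd p)     = CycAdj-sym (reflect-successor j' j p)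
reflect-CycAdj {j = j} {j'} (wrap₁ p q) = reflect-wrap j j' p q
reflect-CycAdj {j = j} {j'} (wrap₂ p q) = CycAdj-sym (reflect-wrap j' j p q)

reflect-end : ∀ {n ℓ ℓ'} → 2 ≤ ℓ → ℓ + ℓ' ≡ 2 + n →
  ∀ {j : Fin n} → toℕ j ≡ ℓ ∸ 1 → toℕ (reflect j) ≡ ℓ' ∸ 1
reflect-end (s≤s (s≤s _)) _ {zero} ()
reflect-end {n} {suc (suc l)} {ℓ'} (s≤s (s≤s _)) e {suc k} p = begin
  toℕ (reflect (suc k))  ≡⟨ toℕ-reflect-suc k ⟩
  n ∸ toℕ (suc k)        ≡⟨ cong (n ∸_) p ⟩
  n ∸ suc l              ≡⟨ cong (_∸ suc l) (suc-injective (suc-injective e)) ⟨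
  l + ℓ' ∸ suc l         ≡⟨ cong (l + ℓ' ∸_) (+-comm l 1) ⟨
  l + ℓ' ∸ (l + 1)       ≡⟨ ∸-+-assoc (l + ℓ') l 1 ⟨
  l + ℓ' ∸ l ∸ 1         ≡⟨ cong (_∸ 1) (m+n∸m≡n l ℓ') ⟩
  ℓ' ∸ 1                 ∎
  where open ≡-Reasoning

proposition5 : (t n ℓ : ℕ) → 2 ≤ t → 3 ≤ n → 2 ≤ ℓ → ℓ ≤ n →
    PathCycle ℓ t n ≅ PathCycle (n ∸ ℓ + 2) t n
proposition5 _ n ℓ _ _ 2≤ℓ ℓ≤n =
  involution⇒PathCycle-≅ reflect reflect-CycAdj toℕ-reflect-zero reflect-involutive
    (reflect-end 2≤ℓ ℓ+ℓ'≡2+n) (reflect-end (m≤n+m 2 (n ∸ ℓ)) (trans (+-comm (n ∸ ℓ + 2) ℓ) ℓ+ℓ'≡2+n))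
  where
  open ≡-Reasoning
  ℓ+ℓ'≡2+n : ℓ + (n ∸ ℓ + 2) ≡ 2 + n
  ℓ+ℓ'≡2+n = begin
    ℓ + (n ∸ ℓ + 2)  ≡⟨ +-assoc ℓ (n ∸ ℓ) 2 ⟨
    ℓ + (n ∸ ℓ) + 2  ≡⟨ cong (_+ 2) (m+[n∸m]≡n ℓ≤n) ⟩
    n + 2            ≡⟨ +-comm n 2 ⟩
    2 + n            ∎
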